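{- Let $\mathcal{H}=(V,E)$ be a $3$-uniform hypergraph of girth at least $4$. The submonoid of $M_\mathcal{H}$ generated (as a monoid) by $\{\mathsf{t},\mathsf{e}\mathsf{t}\mathsf{e}\}$ is isomorphic to ${\bf B}_2^1$.
   Context: ${\bf B}_2^1$ is the six-element Brandt monoid $\langle \mathsf{a},\mathsf{b}\mid \mathsf{a}\mathsf{b}\mathsf{a}=\mathsf{a},\ \mathsf{b}\mathsf{a}\mathsf{b}=\mathsf{b},\ \mathsf{a}\mathsf{a}=\mathsf{b}\mathsf{b}=0\rangle$. Hypergraphs have no isolated vertices (so $E\neq\varnothing$ when $V\ne\varnothing$); girth is the length of a shortest cycle (a cycle being $v_0,e_0,\dots,v_{n-1},e_{n-1}$ with distinct vertices, distinct hyperedges and $v_{i+1}\in e_i\cap e_{i+1}$, indices mod $n$). For $2$-subsets of $V$, $\{u,v\}\equiv\{x,y\}$ iff there is $w$ with $\{u,v,w\},\{x,y,w\}\in E$, or neither is contained in a hyperedge. $M_\mathcal{H}$ is the monoid with identity $1$ generated by a zero $0$, an element $\mathsf{t}$ and the elements of $V$ subject to: $\mathsf{t}^2=\mathsf{t}u\mathsf{t}=\mathsf{t}uv\mathsf{t}=0$ ($u,v\in V$); $uv=vu$; $uu=0$; $uv=0$ whenever no hyperedge contains $\{u,v\}$; $\mathsf{t}uvw\mathsf{t}=\mathsf{t}$ for $\{u,v,w\}\in E$; $uvw=u'v'w'$ for all $\{u,v,w\},\{u',v',w'\}\in E$ (this common element is denoted $\mathsf{e}$); $\mathsf{e}\mathsf{t}\mathsf{e}=\mathsf{e}$;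 and $uv=u'v'$ whenever $\{u,v\}\equiv\{u',v'\}$. -}

module Defs where

open import Data.Nat using (ℕ; zero; suc; _≤_; _<?_; s≤s)
open import Data.Fin using (Fin; toℕ; fromℕ<) renaming (zero to fzero)
open import Data.List using (List; []; _∷_; _++_)
open import Data.Product using (Σ; ∃; ∃-syntax; _×_; _,_)
open import Data.Sum using (_⊎_)
open import Data.Empty using (⊥)
open import Relation.Nullary using (¬_; yes; no)
open import Relation.Binary.PropositionalEquality using (_≡_; _≢_)

-- E u v w  means  {u,v,w} ∈ E  (a 3-element subset of V).  The relation
-- is required to hold only on pairwise distinct vertices and to be
-- invariant under permutations, so it is exactly a set of 3-subsets.

record Hypergraph : Set₁ where
  field
    V          : Set
    E          : V → V → V → Set
    E-distinct : ∀ {u v w} → E u v w → (u ≢ v) × (v ≢ w) × (u ≢ w)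
    E-swap₁    : ∀ {u v w} → E u v w → E v u w
    E-swap₂    : ∀ {u v w} → E u v w → E u w v
    noIsolated : ∀ v → ∃[ u ] ∃[ w ] E v u w

next : ∀ {n} → Fin n → Fin n
next {suc n} i with suc (toℕ i) <? suc n
... | yes p = fromℕ< p
... | no  _ = fzero

module HG (H : Hypergraph) where
  open Hypergraph H

  Edge : Set
  Edge = Σ (V × V × V) λ { (a , b , c) → E a b c }

  _∈ₑ_ : V → Edge → Set
  x ∈ₑ ((a , b , c) , _) = (x ≡ a) ⊎ (x ≡ b) ⊎ (x ≡ c)

  -- equality of hyperedges as subsets of V
  SameEdge : Edge → Edge → Set
  SameEdge e f = ∀ x → (x ∈ₑ e → x ∈ₑ f) × (x ∈ₑ f → x ∈ₑ e)

  record Cycle (n : ℕ) : Set where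
    field
      length≥2 : 2 ≤ n
      vtx      : Fin n → V
      edg      : Fin n → Edge
      vtx-inj  : ∀ i j → vtx i ≡ vtx j → i ≡ j
      edg-inj  : ∀ i j → SameEdge (edg i) (edg j) → i ≡ j
      incid₁   : ∀ i → vtx (next i) ∈ₑ edg i
      incid₂   : ∀ i → vtx (next i) ∈ₑ edg (next i)

  -- girth at least 4: every cycle has length at least 4
  -- (acyclic hypergraphs, of infinite girth, qualify)
  GirthAtLeast4 : Set
  GirthAtLeast4 = ∀ n → Cycle n → 4 ≤ n

  -- The monoid M_H, as words over the generators modulo the congruence
  -- generated by the defining relations.  Identity 1 = empty word.

  data Gen : Set where
    𝟎 : Gen
    𝐭 : Gen
    vx : V → Gen

  Word : Set
  Word = List Gen

  PairEquiv : V → V → V → V → Set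
  PairEquiv u v x y =
    (u ≢ v) × (x ≢ y) ×
    ((∃[ w ] (E u v w × E x y w)) ⊎
     ((∀ w → ¬ E u v w) × (∀ w → ¬ E x y w)))

  data Rel : Word → Word → Set where
    zeroˡ  : ∀ g → Rel (𝟎 ∷ g ∷ []) (𝟎 ∷ [])
    zeroʳ  : ∀ g → Rel (g ∷ 𝟎 ∷ []) (𝟎 ∷ [])
    tt     : Rel (𝐭 ∷ 𝐭 ∷ []) (𝟎 ∷ [])
    tut    : ∀ u → Rel (𝐭 ∷ vx u ∷ 𝐭 ∷ []) (𝟎 ∷ [])
    tuvt   : ∀ u v → Rel (𝐭 ∷ vx u ∷ vx v ∷ 𝐭 ∷ []) (𝟎 ∷ [])
    comm   : ∀ u v → Rel (vx u ∷ vx v ∷ []) (vx v ∷ vx u ∷ [])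
    uu     : ∀ u → Rel (vx u ∷ vx u ∷ []) (𝟎 ∷ [])
    nonadj : ∀ u v → (∀ w → ¬ E u v w) → Rel (vx u ∷ vx v ∷ []) (𝟎 ∷ [])
    tuvwt  : ∀ u v w → E u v w →
             Rel (𝐭 ∷ vx u ∷ vx v ∷ vx w ∷ 𝐭 ∷ []) (𝐭 ∷ [])
    edges  : ∀ u v w u' v' w' → E u v w → E u' v' w' →
             Rel (vx u ∷ vx v ∷ vx w ∷ []) (vx u' ∷ vx v' ∷ vx w' ∷ [])
    ete    : ∀ u v w → E u v w →
             Rel (vx u ∷ vx v ∷ vx w ∷ 𝐭 ∷ vx u ∷ vx v ∷ vx w ∷ [])
                 (vx u ∷ vx v ∷ vx w ∷ [])
    pairs  : ∀ u v u' v' → PairEquiv u v u' v' →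
             Rel (vx u ∷ vx v ∷ []) (vx u' ∷ vx v' ∷ [])

  infix 4 _∼_
  data _∼_ : Word → Word → Set where
    ax    : ∀ {x y} → Rel x y → x ∼ y
    ∼refl : ∀ {x} → x ∼ x
    ∼sym  : ∀ {x y} → x ∼ y → y ∼ x
    ∼trans : ∀ {x y z} → x ∼ y → y ∼ z → x ∼ z
    ∼cong : ∀ p q {x y} → x ∼ y → (p ++ x ++ q) ∼ (p ++ y ++ q)

  eW : V → V → V → Word
  eW u v w = vx u ∷ vx v ∷ vx w ∷ []

  eteW : V → V → V → Word
  eteW u v w = eW u v w ++ 𝐭 ∷ [] ++ eW u v w

  data InSub (u v w : V) : Word → Set where
    nil  : InSub u v w []
    consT : ∀ {x} → InSub u v w x → InSub u v w (𝐭 ∷ x)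
    consE : ∀ {x} → InSub u v w x → InSub u v w (eteW u v w ++ x)

data B21 : Set where
  one a b ab ba zer : B21

_·_ : B21 → B21 → B21
one · y = y
a · one = a
b · one = b
ab · one = ab
ba · one = ba
zer · _ = zer
a · zer = zer
b · zer = zer
ab · zer = zer
ba · zer = zer
a · a = zer
a · b = ab
a · ab = zer
a · ba = a
b · a = ba
b · b = zer
b · ab = b
b · ba = zer
ab · a = a
ab · b = zer
ab · ab = ab
ab · ba = zer
ba · a = zer
ba · b = b
ba · ab = zer
ba · ba = ba

-- The submonoid of M_H generated by {t, ete} (for e = uvw) is isomorphic
-- to B₂¹: there is a map φ : B₂¹ → M_H that is a monoid homomorphism,
-- injective, with image exactly that submonoid.

module _ (H : Hypergraph) where
  open Hypergraph H
  open HG H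

  SubmonoidIsoB21 : V → V → V → Set
  SubmonoidIsoB21 u v w =
    Σ (B21 → Word) λ φ →
      (φ one ∼ []) ×
      (∀ x y → φ (x · y) ∼ (φ x ++ φ y)) ×
      (∀ x y → φ x ∼ φ y → x ≡ y) ×
      (∀ x → ∃[ s ] (InSub u v w s × φ x ∼ s)) ×
      (∀ s → InSub u v w s → ∃[ x ] (s ∼ φ x))

open HG public

-- Write e = uvw.  The relations tt = 0, ee = 0 (from uu = 0 and commutativity), tet = t
-- and ete = e are exactly the relations of B₂¹ for a = t and b = ete, so t ↦ a, ete ↦ b
-- gives a homomorphism from B₂¹ onto the submonoid.  For injectivity, let words act on a
-- nondeterministic automaton with two poles 0 and 1: t leads from 0 to 1, and a hyperedge
-- uvw leads from 1 to 0 by remembering u and then the vertex completing {u, v} to a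
-- hyperedge.  Girth at least 4 makes that vertex unique (two hyperedges through one pair
-- would form a 2-cycle), which is what the relation uv = u'v' needs; since this uniqueness
-- is only available up to double negation, M_H preserves runs up to double negation.  On
-- the poles, t, ete, t·ete and ete·t act as the four 2 × 2 matrix units, so distinct
-- elements of B₂¹ act differently.
module Submission where

open import Defs
  using (Hypergraph; module HG; GirthAtLeast4; SubmonoidIsoB21; B21; one; a; b; ab; ba; zer; _·_)
open import Data.Nat using (s≤s; z≤n)
open import Data.Fin using (Fin; zero; suc)
open import Data.Fin.Properties using (_≟_)
open import Data.List using ([]; _∷_; _++_)
open import Data.List.Properties using (++-identityʳ)
open import Data.Maybe using (Maybe; just; nothing)
import Data.Maybe.Properties as Maybe
open import Function using (_∘_)
open import Data.Product using (∃-syntax; _×_; _,_; proj₁; proj₂; swap)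
open import Data.Sum using (_⊎_; inj₁; inj₂)
open import Effect.Monad using (RawMonad)
open import Level using (0ℓ)
open import Relation.Binary.Bundles using (Setoid)
open import Relation.Binary.Definitions using (DecidableEquality)
open import Relation.Binary.PropositionalEquality using (_≡_; _≢_; refl; sym; cong; cong₂; subst₂; module ≡-Reasoning)
import Relation.Binary.Reasoning.Setoid as SetoidReasoning
open import Relation.Nullary using (¬_; contradiction)
open import Relation.Nullary.Decidable using (decidable-stable)
open import Relation.Nullary.Negation using (¬¬-Monad; ¬¬-map)

open RawMonad (¬¬-Monad {a = 0ℓ}) using (return; _>>=_)

just-stable : ∀ {A : Set} → DecidableEquality A → {m n : Maybe A} →
              (∀ {j} → m ≡ just j → ¬ ¬ n ≡ just j) →
              (∀ {j} → n ≡ just j → ¬ ¬ m ≡ just j) → m ≡ n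
just-stable _≟ₐ_ {just j} m⇒n _ = sym (decidable-stable (Maybe.≡-dec _≟ₐ_ _ _) (m⇒n refl))
just-stable _≟ₐ_ {nothing} {nothing} _ _ = refl
just-stable _≟ₐ_ {nothing} {just j} _ n⇒m = contradiction (λ ()) (n⇒m refl)

ab·≡a·b· : ∀ y → ab · y ≡ a · (b · y)
ab·≡a·b· one = refl
ab·≡a·b· a   = refl
ab·≡a·b· b   = refl
ab·≡a·b· ab  = refl
ab·≡a·b· ba  = refl
ab·≡a·b· zer = refl

ba·≡b·a· : ∀ y → ba · y ≡ b · (a · y)
ba·≡b·a· one = refl
ba·≡b·a· a   = refl
ba·≡b·a· b   = refl
ba·≡b·a· ab  = refl
ba·≡b·a· ba  = refl
ba·≡b·a· zer = refl

onPoles : B21 → Fin 2 → Maybe (Fin 2)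
onPoles one i          = just i
onPoles a   zero       = just (suc zero)
onPoles a   (suc zero) = nothing
onPoles b   zero       = nothing
onPoles b   (suc zero) = just zero
onPoles ab  zero       = just zero
onPoles ab  (suc zero) = nothing
onPoles ba  zero       = nothing
onPoles ba  (suc zero) = just (suc zero)
onPoles zer _          = nothing

fromPoles : Maybe (Fin 2) → Maybe (Fin 2) → B21
fromPoles (just zero)       (just (suc zero)) = one
fromPoles (just (suc zero)) nothing           = a
fromPoles nothing           (just zero)       = b
fromPoles (just zero)       nothing           = ab
fromPoles nothing           (just (suc zero)) = ba
fromPoles _                 _                 = zer

fromPoles-onPoles : ∀ x → fromPoles (onPoles x zero) (onPoles x (suc zero)) ≡ x
fromPoles-onPoles one = refl
fromPoles-onPoles a   = refl
fromPoles-onPoles b   = refl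
fromPoles-onPoles ab  = refl
fromPoles-onPoles ba  = refl
fromPoles-onPoles zer = refl

onPoles-injective : ∀ {x y} → (∀ i → onPoles x i ≡ onPoles y i) → x ≡ y
onPoles-injective {x} {y} same = begin
  x                                                ≡⟨ sym (fromPoles-onPoles x) ⟩
  fromPoles (onPoles x zero) (onPoles x (suc zero)) ≡⟨ cong₂ fromPoles (same zero) (same (suc zero)) ⟩
  fromPoles (onPoles y zero) (onPoles y (suc zero)) ≡⟨ fromPoles-onPoles y ⟩
  y                                                ∎
  where open ≡-Reasoning

module _ (H : Hypergraph) where
  open Hypergraph H
  open HG H hiding (GirthAtLeast4)

  two-edges-through-pair-cycle : ∀ {x y z z'} → E x y z → E x y z' → z ≢ z' → Cycle 2
  two-edges-through-pair-cycle {x} {y} {z} {z'} xyz xyz' z≢z' = record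
    { length≥2 = s≤s (s≤s z≤n)
    ; vtx      = vtx
    ; edg      = edg
    ; vtx-inj  = vtx-inj
    ; edg-inj  = edg-inj
    ; incid₁   = λ { zero → inj₂ (inj₁ refl) ; (suc zero) → inj₁ refl }
    ; incid₂   = λ { zero → inj₂ (inj₁ refl) ; (suc zero) → inj₁ refl }
    }
    where
    x≢y : x ≢ y
    x≢y = proj₁ (E-distinct xyz)

    z∉xyz' : ∀ {A : Set} → z ≡ x ⊎ z ≡ y ⊎ z ≡ z' → A
    z∉xyz' (inj₁ z≡x)         = contradiction (sym z≡x) (proj₂ (proj₂ (E-distinct xyz)))
    z∉xyz' (inj₂ (inj₁ z≡y)) = contradiction (sym z≡y) (proj₁ (proj₂ (E-distinct xyz)))
    z∉xyz' (inj₂ (inj₂ z≡z')) = contradiction z≡z' z≢z'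

    vtx : Fin 2 → V
    vtx zero       = x
    vtx (suc zero) = y

    edg : Fin 2 → Edge
    edg zero       = (x , y , z) , xyz
    edg (suc zero) = (x , y , z') , xyz'

    vtx-inj : ∀ i j → vtx i ≡ vtx j → i ≡ j
    vtx-inj zero       zero       _   = refl
    vtx-inj zero       (suc zero) x≡y = contradiction x≡y x≢y
    vtx-inj (suc zero) zero       y≡x = contradiction (sym y≡x) x≢y
    vtx-inj (suc zero) (suc zero) _   = refl

    edg-inj : ∀ i j → SameEdge (edg i) (edg j) → i ≡ j
    edg-inj zero       zero       _    = refl
    edg-inj zero       (suc zero) same = z∉xyz' (proj₁ (same z) (inj₂ (inj₂ refl)))
    edg-inj (suc zero) zero       same = z∉xyz' (proj₂ (same z) (inj₂ (inj₂ refl)))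
    edg-inj (suc zero) (suc zero) _    = refl

  third-vertex-unique : GirthAtLeast4 H → ∀ {x y z z'} → E x y z → E x y z' → ¬ ¬ z ≡ z'
  third-vertex-unique girth xyz xyz' z≢z' with girth 2 (two-edges-through-pair-cycle xyz xyz' z≢z')
  ... | s≤s (s≤s ())

  -- after x: the first vertex x of a hyperedge has been read;
  -- await z: z is the vertex completing the two vertices read to a hyperedge.
  data State : Set where
    pole  : Fin 2 → State
    after : V → State
    await : V → State

  data Step : Gen → State → State → Set where
    step-t      : Step 𝐭 (pole zero) (pole (suc zero))
    step-first  : ∀ x → Step (vx x) (pole (suc zero)) (after x)
    step-second : ∀ {x y z} → E y x z → Step (vx x) (after y) (await z)
    step-third  : ∀ z → Step (vx z) (await z) (pole zero)

  data Run : Word → State → State → Set where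
    []  : ∀ {p} → Run [] p p
    _∷_ : ∀ {g x p r q} → Step g p r → Run x r q → Run (g ∷ x) p q

  _++ᵣ_ : ∀ {x y p r q} → Run x p r → Run y r q → Run (x ++ y) p q
  []       ++ᵣ ρ = ρ
  (s ∷ σ) ++ᵣ ρ = s ∷ (σ ++ᵣ ρ)

  split-run : ∀ x {y p q} → Run (x ++ y) p q → ∃[ r ] (Run x p r × Run y r q)
  split-run []      ρ       = _ , [] , ρ
  split-run (_ ∷ x) (s ∷ ρ) with split-run x ρ
  ... | r , σ , τ = r , s ∷ σ , τ

  edge-run : ∀ {u v w} → E u v w → Run (eW u v w) (pole (suc zero)) (pole zero)
  edge-run {u} {w = w} uvw = step-first u ∷ step-second uvw ∷ step-third w ∷ []

  infix 4 _⊑_ _≋_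

  _⊑_ : Word → Word → Set
  x ⊑ y = ∀ {p q} → Run x p q → ¬ ¬ Run y p q

  _≋_ : Word → Word → Set
  x ≋ y = x ⊑ y × y ⊑ x

  ⊑-trans : ∀ {x y z} → x ⊑ y → y ⊑ z → x ⊑ z
  ⊑-trans x⊑y y⊑z ρ = x⊑y ρ >>= y⊑z

  ⊑-cong : ∀ l r {x y} → x ⊑ y → l ++ x ++ r ⊑ l ++ y ++ r
  ⊑-cong l r {x} x⊑y ρ with split-run l ρ
  ... | _ , l-run , ρ' with split-run x ρ'
  ... | _ , x-run , r-run = x⊑y x-run >>= λ y-run → return (l-run ++ᵣ (y-run ++ᵣ r-run))

  𝟎-⊑ : ∀ {y} → 𝟎 ∷ [] ⊑ y
  𝟎-⊑ (() ∷ _)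

  comm-⊑ : ∀ u v → vx u ∷ vx v ∷ [] ⊑ vx v ∷ vx u ∷ []
  comm-⊑ u v (step-first _ ∷ step-second uvz ∷ []) =
    return (step-first v ∷ step-second (E-swap₁ uvz) ∷ [])
  comm-⊑ u v (step-second yuv ∷ step-third _ ∷ []) =
    return (step-second (E-swap₂ yuv) ∷ step-third u ∷ [])
  comm-⊑ u v (step-third _ ∷ () ∷ [])

  uu-⊑ : ∀ u → vx u ∷ vx u ∷ [] ⊑ 𝟎 ∷ []
  uu-⊑ u (step-first _ ∷ step-second uuz ∷ [])  = contradiction refl (proj₁ (E-distinct uuz))
  uu-⊑ u (step-second yuu ∷ step-third _ ∷ []) = contradiction refl (proj₁ (proj₂ (E-distinct yuu)))
  uu-⊑ u (step-third _ ∷ () ∷ [])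

  nonadj-⊑ : ∀ u v → (∀ w → ¬ E u v w) → vx u ∷ vx v ∷ [] ⊑ 𝟎 ∷ []
  nonadj-⊑ u v uv∉E (step-first _ ∷ step-second uvz ∷ [])  = contradiction uvz (uv∉E _)
  nonadj-⊑ u v uv∉E (step-second yuv ∷ step-third _ ∷ []) =
    contradiction (E-swap₂ (E-swap₁ yuv)) (uv∉E _)
  nonadj-⊑ u v uv∉E (step-third _ ∷ () ∷ [])

  edge-run-poles : ∀ {u v w p q} → Run (eW u v w) p q → p ≡ pole (suc zero) × q ≡ pole zero
  edge-run-poles (step-first _ ∷ step-second _ ∷ step-third _ ∷ []) = refl , refl
  edge-run-poles (step-second _ ∷ step-third _ ∷ () ∷ [])
  edge-run-poles (step-third _ ∷ () ∷ _)

  ete-run-poles : ∀ {u v w p q} → Run (eteW u v w) p q → p ≡ pole (suc zero) × q ≡ pole zero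
  ete-run-poles {u} {v} {w} ρ with split-run (eW u v w) ρ
  ... | _ , ρ₁ , step-t ∷ ρ₂ with edge-run-poles ρ₁ | edge-run-poles ρ₂
  ... | refl , refl | refl , refl = refl , refl

  edges-⊑ : ∀ {u v w u' v' w'} → E u' v' w' → eW u v w ⊑ eW u' v' w'
  edges-⊑ uvw' ρ with edge-run-poles ρ
  ... | refl , refl = return (edge-run uvw')

  ete-⊑ : ∀ {u v w} → E u v w → eteW u v w ⊑ eW u v w
  ete-⊑ uvw ρ with ete-run-poles ρ
  ... | refl , refl = return (edge-run uvw)

  e-⊑-ete : ∀ {u v w} → E u v w → eW u v w ⊑ eteW u v w
  e-⊑-ete uvw ρ with edge-run-poles ρ
  ... | refl , refl = return (edge-run uvw ++ᵣ (step-t ∷ edge-run uvw))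

  tuvwt-≋ : ∀ {u v w} → E u v w → 𝐭 ∷ eW u v w ++ 𝐭 ∷ [] ≋ 𝐭 ∷ []
  tuvwt-≋ uvw =
      (λ { (step-t ∷ step-first _ ∷ step-second _ ∷ step-third _ ∷ step-t ∷ []) → return (step-t ∷ []) })
    , (λ { (step-t ∷ []) → return (step-t ∷ edge-run uvw ++ᵣ (step-t ∷ [])) })

  PairEquiv-sym : ∀ {u v u' v'} → PairEquiv u v u' v' → PairEquiv u' v' u v
  PairEquiv-sym (u≢v , u'≢v' , inj₁ (w , uvw , uvw')) = u'≢v' , u≢v , inj₁ (w , uvw' , uvw)
  PairEquiv-sym (u≢v , u'≢v' , inj₂ (uv∉E , u'v'∉E)) = u'≢v' , u≢v , inj₂ (u'v'∉E , uv∉E)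

  module _ (girth : GirthAtLeast4 H) where

    pairs-⊑ : ∀ {u v u' v'} → PairEquiv u v u' v' → vx u ∷ vx v ∷ [] ⊑ vx u' ∷ vx v' ∷ []
    pairs-⊑ (_ , _ , inj₁ (w , uvw , uvw')) (step-first _ ∷ step-second uvz ∷ []) =
      third-vertex-unique girth uvz uvw >>= λ { refl → return (step-first _ ∷ step-second uvw' ∷ []) }
    pairs-⊑ (_ , _ , inj₁ (w , uvw , uvw')) (step-second yuv ∷ step-third _ ∷ []) =
      third-vertex-unique girth (E-swap₂ (E-swap₁ yuv)) uvw >>= λ { refl →
        return (step-second (E-swap₁ (E-swap₂ uvw')) ∷ step-third _ ∷ []) }
    pairs-⊑ (_ , _ , inj₂ (uv∉E , _)) ρ = nonadj-⊑ _ _ uv∉E ρ >>= 𝟎-⊑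
    pairs-⊑ _ (step-third _ ∷ () ∷ [])

    Rel⇒≋ : ∀ {x y} → Rel x y → x ≋ y
    Rel⇒≋ (zeroˡ g)     = (λ { (() ∷ _) }) , 𝟎-⊑
    Rel⇒≋ (zeroʳ g)     = (λ { (_ ∷ () ∷ _) }) , 𝟎-⊑
    Rel⇒≋ tt            = (λ { (step-t ∷ () ∷ _) }) , 𝟎-⊑
    Rel⇒≋ (tut u)       = (λ { (step-t ∷ step-first _ ∷ () ∷ _) }) , 𝟎-⊑
    Rel⇒≋ (tuvt u v)    = (λ { (step-t ∷ step-first _ ∷ step-second _ ∷ () ∷ _) }) , 𝟎-⊑
    Rel⇒≋ (comm u v)    = comm-⊑ u v , comm-⊑ v u
    Rel⇒≋ (uu u)        = uu-⊑ u , 𝟎-⊑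
    Rel⇒≋ (nonadj u v uv∉E) = nonadj-⊑ u v uv∉E , 𝟎-⊑
    Rel⇒≋ (tuvwt u v w uvw) = tuvwt-≋ uvw
    Rel⇒≋ (edges u v w u' v' w' uvw uvw') = edges-⊑ uvw' , edges-⊑ uvw
    Rel⇒≋ (ete u v w uvw) = ete-⊑ uvw , e-⊑-ete uvw
    Rel⇒≋ (pairs u v u' v' uv≡u'v') = pairs-⊑ uv≡u'v' , pairs-⊑ (PairEquiv-sym uv≡u'v')

    ∼⇒≋ : ∀ {x y} → x ∼ y → x ≋ y
    ∼⇒≋ (ax r)            = Rel⇒≋ r
    ∼⇒≋ ∼refl             = return , return
    ∼⇒≋ (∼sym x∼y)        = swap (∼⇒≋ x∼y)
    ∼⇒≋ (∼trans x∼y y∼z)  = ⊑-trans (proj₁ (∼⇒≋ x∼y)) (proj₁ (∼⇒≋ y∼z))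
                          , ⊑-trans (proj₂ (∼⇒≋ y∼z)) (proj₂ (∼⇒≋ x∼y))
    ∼⇒≋ (∼cong l r x∼y)   = ⊑-cong l r (proj₁ (∼⇒≋ x∼y)) , ⊑-cong l r (proj₂ (∼⇒≋ x∼y))

  ∼-setoid : Setoid _ _
  ∼-setoid = record
    { Carrier       = Word
    ; _≈_           = _∼_
    ; isEquivalence = record { refl = ∼refl ; sym = ∼sym ; trans = ∼trans }
    }

  ∼-prefix : ∀ l {x y} → x ∼ y → l ++ x ∼ l ++ y
  ∼-prefix l {x} {y} x∼y =
    subst₂ (λ x' y' → l ++ x' ∼ l ++ y') (++-identityʳ x) (++-identityʳ y) (∼cong l [] x∼y)

  𝟎-absorbsˡ : ∀ r → 𝟎 ∷ r ∼ 𝟎 ∷ []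
  𝟎-absorbsˡ []      = ∼refl
  𝟎-absorbsˡ (g ∷ r) = ∼trans (∼cong [] r (ax (zeroˡ g))) (𝟎-absorbsˡ r)

  𝟎-absorbs : ∀ l r → l ++ 𝟎 ∷ r ∼ 𝟎 ∷ []
  𝟎-absorbs []      r = 𝟎-absorbsˡ r
  𝟎-absorbs (g ∷ l) r = ∼trans (∼-prefix (g ∷ []) (𝟎-absorbs l r)) (ax (zeroʳ g))

  annihilates : ∀ l r {x} → x ∼ 𝟎 ∷ [] → l ++ x ++ r ∼ 𝟎 ∷ []
  annihilates l r x∼𝟎 = ∼trans (∼cong l r x∼𝟎) (𝟎-absorbs l r)

  e²∼𝟎 : ∀ u v w → eW u v w ++ eW u v w ∼ 𝟎 ∷ []
  e²∼𝟎 u v w = begin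
    vx u ∷ vx v ∷ vx w ∷ vx u ∷ vx v ∷ vx w ∷ [] ≈⟨ ∼cong (vx u ∷ vx v ∷ []) (vx v ∷ vx w ∷ []) (ax (comm w u)) ⟩
    vx u ∷ vx v ∷ vx u ∷ vx w ∷ vx v ∷ vx w ∷ [] ≈⟨ ∼cong (vx u ∷ []) (vx w ∷ vx v ∷ vx w ∷ []) (ax (comm v u)) ⟩
    vx u ∷ vx u ∷ vx v ∷ vx w ∷ vx v ∷ vx w ∷ [] ≈⟨ annihilates [] (vx v ∷ vx w ∷ vx v ∷ vx w ∷ []) (ax (uu u)) ⟩
    𝟎 ∷ []                                        ∎
    where open SetoidReasoning ∼-setoid

  module _ {u v w : V} (uvw : E u v w) where

    𝐞 𝐞𝐭𝐞 : Word
    𝐞   = eW u v w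
    𝐞𝐭𝐞 = eteW u v w

    φ : B21 → Word
    φ one = []
    φ a   = 𝐭 ∷ []
    φ b   = 𝐞𝐭𝐞
    φ ab  = 𝐭 ∷ 𝐞𝐭𝐞
    φ ba  = 𝐞𝐭𝐞 ++ 𝐭 ∷ []
    φ zer = 𝟎 ∷ []

    tet∼t : 𝐭 ∷ 𝐞 ++ 𝐭 ∷ [] ∼ 𝐭 ∷ []
    tet∼t = ax (tuvwt u v w uvw)

    ete∼e : 𝐞𝐭𝐞 ∼ 𝐞
    ete∼e = ax (ete u v w uvw)

    φ-a· : ∀ y → φ (a · y) ∼ φ a ++ φ y
    φ-a· one = ∼refl
    φ-a· a   = ∼sym (ax tt)
    φ-a· b   = ∼refl
    φ-a· ab  = ∼sym (annihilates [] 𝐞𝐭𝐞 (ax tt))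
    φ-a· ba  = ∼sym (∼trans (∼cong [] (𝐞 ++ 𝐭 ∷ []) tet∼t) tet∼t)
    φ-a· zer = ∼sym (ax (zeroʳ 𝐭))

    φ-b· : ∀ y → φ (b · y) ∼ φ b ++ φ y
    φ-b· one = ∼refl
    φ-b· a   = ∼refl
    φ-b· b   = ∼sym (annihilates (𝐞 ++ 𝐭 ∷ []) (𝐭 ∷ 𝐞) (e²∼𝟎 u v w))
    φ-b· ab  = ∼sym (∼trans (∼cong [] (𝐭 ∷ 𝐞 ++ 𝐭 ∷ 𝐞) ete∼e) (∼cong [] (𝐭 ∷ 𝐞) ete∼e))
    φ-b· ba  = ∼sym (annihilates (𝐞 ++ 𝐭 ∷ []) (𝐭 ∷ 𝐞 ++ 𝐭 ∷ []) (e²∼𝟎 u v w))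
    φ-b· zer = ∼sym (𝟎-absorbs 𝐞𝐭𝐞 [])

    φ-homomorphic : ∀ x y → φ (x · y) ∼ φ x ++ φ y
    φ-homomorphic one y = ∼refl
    φ-homomorphic a   y = φ-a· y
    φ-homomorphic b   y = φ-b· y
    φ-homomorphic ab  y = begin
      φ (ab · y)       ≡⟨ cong φ (ab·≡a·b· y) ⟩
      φ (a · (b · y))  ≈⟨ φ-a· (b · y) ⟩
      𝐭 ∷ φ (b · y)    ≈⟨ ∼-prefix (𝐭 ∷ []) (φ-b· y) ⟩
      𝐭 ∷ 𝐞𝐭𝐞 ++ φ y   ∎
      where open SetoidReasoning ∼-setoid
    φ-homomorphic ba  y = begin
      φ (ba · y)       ≡⟨ cong φ (ba·≡b·a· y) ⟩
      φ (b · (a · y))  ≈⟨ φ-b· (a · y) ⟩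
      𝐞𝐭𝐞 ++ φ (a · y) ≈⟨ ∼-prefix 𝐞𝐭𝐞 (φ-a· y) ⟩
      𝐞𝐭𝐞 ++ 𝐭 ∷ φ y   ∎
      where open SetoidReasoning ∼-setoid
    φ-homomorphic zer y = ∼sym (𝟎-absorbsˡ (φ y))

    φ-in-submonoid : ∀ x → ∃[ s ] (InSub u v w s × φ x ∼ s)
    φ-in-submonoid one = [] , nil , ∼refl
    φ-in-submonoid a   = 𝐭 ∷ [] , consT nil , ∼refl
    φ-in-submonoid b   = 𝐞𝐭𝐞 , consE nil , ∼refl
    φ-in-submonoid ab  = 𝐭 ∷ 𝐞𝐭𝐞 , consT (consE nil) , ∼refl
    φ-in-submonoid ba  = 𝐞𝐭𝐞 ++ 𝐭 ∷ [] , consE (consT nil) , ∼refl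
    φ-in-submonoid zer = 𝐭 ∷ 𝐭 ∷ [] , consT (consT nil) , ∼sym (ax tt)

    submonoid-in-φ : ∀ s → InSub u v w s → ∃[ x ] (s ∼ φ x)
    submonoid-in-φ []              nil = one , ∼refl
    submonoid-in-φ (𝐭 ∷ s)         (consT s∈) with submonoid-in-φ s s∈
    ... | x , s∼φx = a · x , ∼trans (∼-prefix (𝐭 ∷ []) s∼φx) (∼sym (φ-a· x))
    submonoid-in-φ .(𝐞𝐭𝐞 ++ s)     (consE {s} s∈) with submonoid-in-φ s s∈
    ... | x , s∼φx = b · x , ∼trans (∼-prefix 𝐞𝐭𝐞 s∼φx) (∼sym (φ-b· x))

    run⇒onPoles : ∀ x {i j} → Run (φ x) (pole i) (pole j) → onPoles x i ≡ just j
    run⇒onPoles one [] = refl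
    run⇒onPoles a   (step-t ∷ []) = refl
    run⇒onPoles b   ρ with ete-run-poles ρ
    ... | refl , refl = refl
    run⇒onPoles ab  (step-t ∷ ρ) with ete-run-poles ρ
    ... | _ , refl = refl
    run⇒onPoles ba  ρ with split-run 𝐞𝐭𝐞 ρ
    ... | _ , ρ₁ , step-t ∷ [] with ete-run-poles ρ₁
    ... | refl , _ = refl
    run⇒onPoles zer (() ∷ _)

    onPoles⇒run : ∀ x {i j} → onPoles x i ≡ just j → Run (φ x) (pole i) (pole j)
    onPoles⇒run one             refl = []
    onPoles⇒run a   {zero}      refl = step-t ∷ []
    onPoles⇒run a   {suc zero}  ()
    onPoles⇒run b   {zero}      ()
    onPoles⇒run b   {suc zero}  refl = edge-run uvw ++ᵣ (step-t ∷ edge-run uvw)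
    onPoles⇒run ab  {zero}      refl = step-t ∷ onPoles⇒run b refl
    onPoles⇒run ab  {suc zero}  ()
    onPoles⇒run ba  {zero}      ()
    onPoles⇒run ba  {suc zero}  refl = onPoles⇒run b refl ++ᵣ (step-t ∷ [])
    onPoles⇒run zer             ()

    φ-injective : GirthAtLeast4 H → ∀ x y → φ x ∼ φ y → x ≡ y
    φ-injective girth x y φx∼φy = onPoles-injective λ i →
      just-stable _≟_ (transport (proj₁ (∼⇒≋ girth φx∼φy))) (transport (proj₂ (∼⇒≋ girth φx∼φy)))
      where
      transport : ∀ {x y i j} → φ x ⊑ φ y → onPoles x i ≡ just j → ¬ ¬ onPoles y i ≡ just j
      transport {x} {y} φx⊑φy = ¬¬-map (run⇒onPoles y) ∘ φx⊑φy ∘ onPoles⇒run x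

lemma2p5 : (H : Hypergraph) → GirthAtLeast4 H →
           ∀ {u v w} → Hypergraph.E H u v w → SubmonoidIsoB21 H u v w
lemma2p5 H girth uvw =
  φ H uvw , ∼refl , φ-homomorphic H uvw , φ-injective H uvw girth ,
  φ-in-submonoid H uvw , submonoid-in-φ H uvw
  where open HG H using (∼refl)
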